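{- Let $\mathcal{V}$ be a symmetric monoidal category with a fixed object $0$. (i) If $(A,B,\epsilon,\mu_A,l,r)$ is a Frobenius structure and $\pi^l_A:=\epsilon\circ(A\otimes l)$, $\pi^r_A:=\epsilon\circ(A\otimes r)$, then $(A,\mu_A,\pi^l_A)$ is an associative bracketed magma, $\pi^r_A$ is co-associative for $\mu_A$, and $\pi^l_A$, $\pi^r_A: A\otimes A\to 0$ are dual pairings. (ii) Conversely, let $(A,\mu_A,\pi_A)$ be an associative bracketed magma such that $\pi_A:A\otimes A\to 0$ is a dual pairing, and let $\epsilon:A\otimes B\to 0$ be a dual pairing. Let $l:A\to B$ be the unique morphism with $\epsilon\circ(A\otimes l)=\pi_A$ and let $r:A\to B$ be the unique morphism with $\epsilon\circ(A\otimes r)=\epsilon\circ(A\otimes l)\circ\sigma_{A,A}$. Then $(A,B,\epsilon,\mu_A,l,r)$ is a Frobenius structure.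
   Context: $\mathcal{V}$ is taken strict with symmetry $\sigma$. A dual pairing is $\epsilon:A\otimes B\to 0$ such that for all $X$ the maps $\hom(X,B)\to\hom(A\otimes X,0)$, $f\mapsto\epsilon\circ(A\otimes f)$, and $\hom(X,A)\to\hom(X\otimes B,0)$, $g\mapsto\epsilon\circ(g\otimes B)$, are bijections. A bracketed magma $(A,\mu_A,\pi_A)$ consists of $\mu_A:A\otimes A\to A$ and $\pi_A:A\otimes A\to 0$; it is associative if $\mu_A$ is associative and $\pi_A\circ(\mu_A\otimes A)=\pi_A\circ(A\otimes\mu_A)$. A pairing $\pi$ is co-associative (for $\mu_A$) if $(A,\mu_A\circ\sigma_{A,A},\pi)$ is an associative bracketed magma. $\lhd:A\otimes B\to B$ is the unique map with $\epsilon\circ(A\otimes\lhd)=\epsilon\circ(\mu_A\otimes B)$, and $\rhd:B\otimes A\to B$ the unique map with $\epsilon\circ(A\otimes\rhd)=\epsilon\circ(\mu_A\otimes B)\circ\sigma_{A\otimes B,A}$. A Frobenius structure is $(A,B,\epsilon,\mu_A,l,r)$ with $\epsilon$ a dual pairing, $\mu_A$ associative, $l,r:A\to B$ isomorphisms with $\epsilon\circ(A\otimes r)=\epsilon\circ(A\otimes l)\circ\sigma_{A,A}$ and $\lhd\circ(A\otimes r)=\rhd\circ(l\otimes A)$. -}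

module Defs where

open import Level using (Level; _⊔_) renaming (suc to lsuc)
open import Relation.Binary.Core using (Rel)
open import Relation.Binary.Structures using (IsEquivalence)
open import Data.Product using (Σ; _×_; _,_)

-- A (not necessarily strict) symmetric monoidal category, with hom-setoids.
-- Equations in the paper (which assumes V strict) are read by inserting
-- associators where needed (Mac Lane coherence).
record SymMonCat (o ℓ e : Level) : Set (lsuc (o ⊔ ℓ ⊔ e)) where
  infixr 9 _∘_
  infixr 10 _⊗₀_ _⊗₁_
  infix  4 _≈_
  field
    Obj : Set o
    _⇒_ : Obj → Obj → Set ℓ
    _≈_ : ∀ {A B} → Rel (A ⇒ B) e
    ≈-equiv : ∀ {A B} → IsEquivalence (_≈_ {A} {B})
    id  : ∀ {A} → A ⇒ A
    _∘_ : ∀ {A B C} → B ⇒ C → A ⇒ B → A ⇒ C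
    assoc : ∀ {A B C D} {f : A ⇒ B} {g : B ⇒ C} {h : C ⇒ D} →
            (h ∘ g) ∘ f ≈ h ∘ (g ∘ f)
    identityˡ : ∀ {A B} {f : A ⇒ B} → id ∘ f ≈ f
    identityʳ : ∀ {A B} {f : A ⇒ B} → f ∘ id ≈ f
    ∘-resp-≈ : ∀ {A B C} {f h : B ⇒ C} {g i : A ⇒ B} →
               f ≈ h → g ≈ i → f ∘ g ≈ h ∘ i
    _⊗₀_ : Obj → Obj → Obj
    _⊗₁_ : ∀ {A B C D} → A ⇒ B → C ⇒ D → (A ⊗₀ C) ⇒ (B ⊗₀ D)
    ⊗-resp-≈ : ∀ {A B C D} {f h : A ⇒ B} {g i : C ⇒ D} →
               f ≈ h → g ≈ i → f ⊗₁ g ≈ h ⊗₁ i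
    ⊗-identity : ∀ {A B} → id {A} ⊗₁ id {B} ≈ id
    ⊗-homomorphism : ∀ {A B C D E F} {f : B ⇒ C} {g : A ⇒ B} {h : E ⇒ F} {i : D ⇒ E} →
                     (f ∘ g) ⊗₁ (h ∘ i) ≈ (f ⊗₁ h) ∘ (g ⊗₁ i)
    unit : Obj
    λ⇒ : ∀ {A} → (unit ⊗₀ A) ⇒ A
    λ⇐ : ∀ {A} → A ⇒ (unit ⊗₀ A)
    ρ⇒ : ∀ {A} → (A ⊗₀ unit) ⇒ A
    ρ⇐ : ∀ {A} → A ⇒ (A ⊗₀ unit)
    α⇒ : ∀ {A B C} → ((A ⊗₀ B) ⊗₀ C) ⇒ (A ⊗₀ (B ⊗₀ C))
    α⇐ : ∀ {A B C} → (A ⊗₀ (B ⊗₀ C)) ⇒ ((A ⊗₀ B) ⊗₀ C)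
    σ  : ∀ {A B} → (A ⊗₀ B) ⇒ (B ⊗₀ A)
    λ-isoˡ : ∀ {A} → λ⇐ ∘ λ⇒ {A} ≈ id
    λ-isoʳ : ∀ {A} → λ⇒ ∘ λ⇐ {A} ≈ id
    ρ-isoˡ : ∀ {A} → ρ⇐ ∘ ρ⇒ {A} ≈ id
    ρ-isoʳ : ∀ {A} → ρ⇒ ∘ ρ⇐ {A} ≈ id
    α-isoˡ : ∀ {A B C} → α⇐ ∘ α⇒ {A} {B} {C} ≈ id
    α-isoʳ : ∀ {A B C} → α⇒ ∘ α⇐ {A} {B} {C} ≈ id
    λ-natural : ∀ {A B} {f : A ⇒ B} → λ⇒ ∘ (id ⊗₁ f) ≈ f ∘ λ⇒
    ρ-natural : ∀ {A B} {f : A ⇒ B} → ρ⇒ ∘ (f ⊗₁ id) ≈ f ∘ ρ⇒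
    α-natural : ∀ {A B C D E F} {f : A ⇒ B} {g : C ⇒ D} {h : E ⇒ F} →
                α⇒ ∘ ((f ⊗₁ g) ⊗₁ h) ≈ (f ⊗₁ (g ⊗₁ h)) ∘ α⇒
    σ-natural : ∀ {A B C D} {f : A ⇒ B} {g : C ⇒ D} →
                σ ∘ (f ⊗₁ g) ≈ (g ⊗₁ f) ∘ σ
    triangle : ∀ {A B} → (id {A} ⊗₁ λ⇒ {B}) ∘ α⇒ ≈ ρ⇒ ⊗₁ id
    pentagon : ∀ {A B C D} →
               (id {A} ⊗₁ α⇒ {B} {C} {D}) ∘ α⇒ ∘ (α⇒ ⊗₁ id) ≈ α⇒ ∘ α⇒
    hexagon : ∀ {A B C} →
              α⇒ {B} {C} {A} ∘ σ {A} {B ⊗₀ C} ∘ α⇒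
                ≈ (id ⊗₁ σ) ∘ α⇒ ∘ (σ ⊗₁ id {C})
    σ-involutive : ∀ {A B} → σ {B} {A} ∘ σ {A} {B} ≈ id

module Notions {o ℓ e} (C : SymMonCat o ℓ e) (𝟘 : SymMonCat.Obj C) where
  open SymMonCat C

  -- bijection of hom-setoids (the maps considered respect ≈ automatically)
  IsBijection : ∀ {X Y Z W} → ((X ⇒ Y) → (Z ⇒ W)) → Set (ℓ ⊔ e)
  IsBijection {X} {Y} φ =
    (∀ (f g : X ⇒ Y) → φ f ≈ φ g → f ≈ g) × (∀ h → Σ (X ⇒ Y) λ f → φ f ≈ h)

  IsDualPairing : ∀ {A B} → (A ⊗₀ B) ⇒ 𝟘 → Set (o ⊔ ℓ ⊔ e)
  IsDualPairing {A} {B} ε =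
    (∀ X → IsBijection {X} {B} {A ⊗₀ X} {𝟘} (λ f → ε ∘ (id ⊗₁ f)))
    × (∀ X → IsBijection {X} {A} {X ⊗₀ B} {𝟘} (λ g → ε ∘ (g ⊗₁ id)))

  IsIso : ∀ {A B} → A ⇒ B → Set (ℓ ⊔ e)
  IsIso {A} {B} f = Σ (B ⇒ A) λ g → (g ∘ f ≈ id) × (f ∘ g ≈ id)

  IsAssociative : ∀ {A} → (A ⊗₀ A) ⇒ A → Set e
  IsAssociative μ = μ ∘ (μ ⊗₁ id) ≈ μ ∘ (id ⊗₁ μ) ∘ α⇒

  IsAssocBracketedMagma : ∀ {A} → (A ⊗₀ A) ⇒ A → (A ⊗₀ A) ⇒ 𝟘 → Set e
  IsAssocBracketedMagma μ π =
    IsAssociative μ × (π ∘ (μ ⊗₁ id) ≈ π ∘ (id ⊗₁ μ) ∘ α⇒)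

  IsCoAssociative : ∀ {A} → (A ⊗₀ A) ⇒ A → (A ⊗₀ A) ⇒ 𝟘 → Set e
  IsCoAssociative μ π = IsAssocBracketedMagma (μ ∘ σ) π

  IsLeftAction : ∀ {A B} → (A ⊗₀ B) ⇒ 𝟘 → (A ⊗₀ A) ⇒ A → (A ⊗₀ B) ⇒ B → Set e
  IsLeftAction ε μ ◁ = ε ∘ (id ⊗₁ ◁) ≈ ε ∘ (μ ⊗₁ id) ∘ α⇐

  IsRightAction : ∀ {A B} → (A ⊗₀ B) ⇒ 𝟘 → (A ⊗₀ A) ⇒ A → (B ⊗₀ A) ⇒ B → Set e
  IsRightAction {A} {B} ε μ ▷ =
    ε ∘ (id ⊗₁ ▷) ∘ α⇒ ≈ ε ∘ (μ ⊗₁ id) ∘ α⇐ ∘ σ {A ⊗₀ B} {A}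

  -- Since ε is a dual pairing,
  -- ◁ and ▷ exist and are unique up to ≈; the compatibility condition is
  -- stated for all maps satisfying their defining equations.
  IsFrobenius : ∀ {A B} → (A ⊗₀ B) ⇒ 𝟘 → (A ⊗₀ A) ⇒ A → A ⇒ B → A ⇒ B →
                Set (o ⊔ ℓ ⊔ e)
  IsFrobenius ε μ l r =
    IsDualPairing ε × IsAssociative μ × IsIso l × IsIso r
    × (ε ∘ (id ⊗₁ r) ≈ ε ∘ (id ⊗₁ l) ∘ σ)
    × (∀ ◁ ▷ → IsLeftAction ε μ ◁ → IsRightAction ε μ ▷ →
         ◁ ∘ (id ⊗₁ r) ≈ ▷ ∘ (l ⊗₁ id))

{-# OPTIONS --safe #-}
-- Write πˡ = ε ∘ (A ⊗ l) and πʳ = ε ∘ (A ⊗ r) = πˡ ∘ σ.  Paired against ε,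
-- the two sides of the Frobenius condition ◁ ∘ (A ⊗ r) = ▷ ∘ (l ⊗ A) become
-- πˡ ∘ (A ⊗ μ) ∘ α⇒ and πˡ ∘ (μ ⊗ A), both precomposed with the cyclic
-- rotation of A ⊗ A ⊗ A.  As ε is nondegenerate and the rotation invertible,
-- the Frobenius condition is equivalent to invariance of πˡ under μ, which
-- proves both directions at once.  Co-associativity of πʳ = πˡ ∘ σ is
-- invariance for the opposite multiplication μ ∘ σ.  Finally, composing a
-- dual pairing with an isomorphism (in either variable) or with σ again gives
-- a dual pairing, and a map comparing two dual pairings is an isomorphism.
module Submission where

open import Data.Product using (Σ; _×_; _,_; proj₁; proj₂)
open import Relation.Binary.Bundles using (Setoid)
open import Relation.Binary.Structures using (IsEquivalence)
import Relation.Binary.Reasoning.Setoid as SetoidReasoning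

open import Defs

module FrobeniusStructures {o ℓ e} (𝒞 : SymMonCat o ℓ e) (𝟘 : SymMonCat.Obj 𝒞) where
  open SymMonCat 𝒞
  open Notions 𝒞 𝟘

  private variable
    A B X Y Z W : Obj
    a b c d f g h i j k k′ : A ⇒ B

  hom-setoid : ∀ {A B : Obj} → Setoid ℓ e
  hom-setoid {A} {B} = record { Carrier = A ⇒ B ; _≈_ = _≈_ ; isEquivalence = ≈-equiv }

  module ≈ {A B : Obj} = IsEquivalence (≈-equiv {A} {B})
  module HomReasoning {A B : Obj} = SetoidReasoning (hom-setoid {A} {B})
  open HomReasoning

  infixr 4 _⟩∘⟨_ refl⟩∘⟨_
  infixl 5 _⟩∘⟨refl

  _⟩∘⟨_ : a ≈ b → c ≈ d → a ∘ c ≈ b ∘ d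
  _⟩∘⟨_ = ∘-resp-≈

  refl⟩∘⟨_ : c ≈ d → a ∘ c ≈ a ∘ d
  refl⟩∘⟨ p = ≈.refl ⟩∘⟨ p

  _⟩∘⟨refl : a ≈ b → a ∘ c ≈ b ∘ c
  p ⟩∘⟨refl = p ⟩∘⟨ ≈.refl

  sym-assoc : h ∘ (g ∘ f) ≈ (h ∘ g) ∘ f
  sym-assoc = ≈.sym assoc

  assoc² : (a ∘ b ∘ c) ∘ d ≈ a ∘ b ∘ c ∘ d
  assoc² = ≈.trans assoc (refl⟩∘⟨ assoc)

  assoc³ : (a ∘ b ∘ c ∘ d) ∘ f ≈ a ∘ b ∘ c ∘ d ∘ f
  assoc³ = ≈.trans assoc (refl⟩∘⟨ assoc²)

  assoc⁴ : (a ∘ b ∘ c ∘ d ∘ f) ∘ g ≈ a ∘ b ∘ c ∘ d ∘ f ∘ g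
  assoc⁴ = ≈.trans assoc (refl⟩∘⟨ assoc³)

  extendʳ : a ∘ b ≈ c ∘ d → a ∘ b ∘ f ≈ c ∘ d ∘ f
  extendʳ p = ≈.trans sym-assoc (≈.trans (p ⟩∘⟨refl) assoc)

  extend₃ʳ : a ∘ b ∘ c ≈ d ∘ g ∘ h → a ∘ b ∘ c ∘ f ≈ d ∘ g ∘ h ∘ f
  extend₃ʳ p = ≈.trans (≈.sym assoc²) (≈.trans (p ⟩∘⟨refl) assoc²)

  cancelˡ : i ∘ j ≈ id → i ∘ j ∘ g ≈ g
  cancelˡ p = ≈.trans sym-assoc (≈.trans (p ⟩∘⟨refl) identityˡ)

  cancelʳ : i ∘ j ≈ id → (f ∘ i) ∘ j ≈ f
  cancelʳ p = ≈.trans assoc (≈.trans (refl⟩∘⟨ p) identityʳ)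

  switch-∘ʳ : k ∘ k′ ≈ id → f ∘ k ≈ g → f ≈ g ∘ k′
  switch-∘ʳ inv p = ≈.trans (≈.sym (cancelʳ inv)) (p ⟩∘⟨refl)

  split-epi-cancelʳ : k ∘ k′ ≈ id → f ∘ k ≈ g ∘ k → f ≈ g
  split-epi-cancelʳ inv p = ≈.trans (switch-∘ʳ inv p) (cancelʳ inv)

  split-mono-cancelˡ : k′ ∘ k ≈ id → k ∘ f ≈ k ∘ g → f ≈ g
  split-mono-cancelˡ inv p =
    ≈.trans (≈.sym (cancelˡ inv)) (≈.trans (refl⟩∘⟨ p) (cancelˡ inv))

  id⊗-homomorphism : id {X} ⊗₁ (f ∘ g) ≈ (id ⊗₁ f) ∘ (id ⊗₁ g)
  id⊗-homomorphism = ≈.trans (⊗-resp-≈ (≈.sym identityˡ) ≈.refl) ⊗-homomorphism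

  ⊗id-homomorphism : (f ∘ g) ⊗₁ id {X} ≈ (f ⊗₁ id) ∘ (g ⊗₁ id)
  ⊗id-homomorphism = ≈.trans (⊗-resp-≈ ≈.refl (≈.sym identityˡ)) ⊗-homomorphism

  pull-id⊗ : (h ∘ (id {X} ⊗₁ f)) ∘ (id ⊗₁ g) ≈ h ∘ (id ⊗₁ (f ∘ g))
  pull-id⊗ = ≈.trans assoc (refl⟩∘⟨ ≈.sym id⊗-homomorphism)

  ⊗-interchange : (f ⊗₁ id) ∘ (id ⊗₁ g) ≈ (id ⊗₁ g) ∘ (f ⊗₁ id)
  ⊗-interchange =
    ≈.trans (≈.sym ⊗-homomorphism)
      (≈.trans (⊗-resp-≈ (≈.trans identityʳ (≈.sym identityˡ))
                         (≈.trans identityˡ (≈.sym identityʳ)))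
               ⊗-homomorphism)

  id⊗-inverse : i ∘ j ≈ id → (id {X} ⊗₁ i) ∘ (id ⊗₁ j) ≈ id
  id⊗-inverse p =
    ≈.trans (≈.sym id⊗-homomorphism) (≈.trans (⊗-resp-≈ ≈.refl p) ⊗-identity)

  ⊗id-inverse : i ∘ j ≈ id → (i ⊗₁ id {X}) ∘ (j ⊗₁ id) ≈ id
  ⊗id-inverse p =
    ≈.trans (≈.sym ⊗id-homomorphism) (≈.trans (⊗-resp-≈ p ≈.refl) ⊗-identity)

  id⊗-iso : IsIso f → IsIso (id {X} ⊗₁ f)
  id⊗-iso (g , gf , fg) = id ⊗₁ g , id⊗-inverse gf , id⊗-inverse fg

  σ-iso : IsIso (σ {A} {B})
  σ-iso = σ , σ-involutive , σ-involutive

  α⇐-natural : α⇐ ∘ (f ⊗₁ (g ⊗₁ h)) ≈ ((f ⊗₁ g) ⊗₁ h) ∘ α⇐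
  α⇐-natural = split-epi-cancelʳ α-isoʳ (begin
    (α⇐ ∘ (_ ⊗₁ (_ ⊗₁ _))) ∘ α⇒   ≈⟨ assoc ⟩
    α⇐ ∘ (_ ⊗₁ (_ ⊗₁ _)) ∘ α⇒     ≈⟨ refl⟩∘⟨ α-natural ⟨
    α⇐ ∘ α⇒ ∘ ((_ ⊗₁ _) ⊗₁ _)     ≈⟨ cancelˡ α-isoˡ ⟩
    (_ ⊗₁ _) ⊗₁ _                 ≈⟨ cancelʳ α-isoˡ ⟨
    (((_ ⊗₁ _) ⊗₁ _) ∘ α⇐) ∘ α⇒   ∎)

  ⊗id∘α⇐-commute : (f ⊗₁ id) ∘ α⇐ ∘ (id ⊗₁ (id ⊗₁ g)) ≈ (id ⊗₁ g) ∘ (f ⊗₁ id) ∘ α⇐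
  ⊗id∘α⇐-commute {f = f} {g = g} = begin
    (f ⊗₁ id) ∘ α⇐ ∘ (id ⊗₁ (id ⊗₁ g))   ≈⟨ refl⟩∘⟨ α⇐-natural ⟩
    (f ⊗₁ id) ∘ ((id ⊗₁ id) ⊗₁ g) ∘ α⇐   ≈⟨ refl⟩∘⟨ ⊗-resp-≈ ⊗-identity ≈.refl ⟩∘⟨refl ⟩
    (f ⊗₁ id) ∘ (id ⊗₁ g) ∘ α⇐           ≈⟨ extendʳ ⊗-interchange ⟩
    (id ⊗₁ g) ∘ (f ⊗₁ id) ∘ α⇐           ∎

  ∘σ-swap : (h ∘ σ) ∘ (f ⊗₁ g) ≈ (h ∘ (g ⊗₁ f)) ∘ σ
  ∘σ-swap = ≈.trans assoc (≈.trans (refl⟩∘⟨ σ-natural) sym-assoc)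

  hexagon₂ : σ {A ⊗₀ B} {X} ≈ α⇒ ∘ (σ ⊗₁ id) ∘ α⇐ ∘ (id ⊗₁ σ) ∘ α⇒
  hexagon₂ =
    ≈.trans (≈.sym identityˡ) (≈.sym (switch-∘ʳ σ-involutive (begin
      (α⇒ ∘ (σ ⊗₁ id) ∘ α⇐ ∘ (id ⊗₁ σ) ∘ α⇒) ∘ σ
        ≈⟨ assoc⁴ ⟩
      α⇒ ∘ (σ ⊗₁ id) ∘ α⇐ ∘ (id ⊗₁ σ) ∘ α⇒ ∘ σ
        ≈⟨ refl⟩∘⟨ refl⟩∘⟨ refl⟩∘⟨ refl⟩∘⟨ hexagon-α⇒∘σ ⟩
      α⇒ ∘ (σ ⊗₁ id) ∘ α⇐ ∘ (id ⊗₁ σ) ∘ (id ⊗₁ σ) ∘ α⇒ ∘ (σ ⊗₁ id) ∘ α⇐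
        ≈⟨ refl⟩∘⟨ refl⟩∘⟨ refl⟩∘⟨ cancelˡ (id⊗-inverse σ-involutive) ⟩
      α⇒ ∘ (σ ⊗₁ id) ∘ α⇐ ∘ α⇒ ∘ (σ ⊗₁ id) ∘ α⇐
        ≈⟨ refl⟩∘⟨ refl⟩∘⟨ cancelˡ α-isoˡ ⟩
      α⇒ ∘ (σ ⊗₁ id) ∘ (σ ⊗₁ id) ∘ α⇐
        ≈⟨ refl⟩∘⟨ cancelˡ (⊗id-inverse σ-involutive) ⟩
      α⇒ ∘ α⇐
        ≈⟨ α-isoʳ ⟩
      id ∎)))
    where
    hexagon-α⇒∘σ : α⇒ ∘ σ {X} {A ⊗₀ B} ≈ (id ⊗₁ σ) ∘ α⇒ ∘ (σ ⊗₁ id) ∘ α⇐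
    hexagon-α⇒∘σ =
      ≈.trans (switch-∘ʳ α-isoʳ (≈.trans assoc hexagon)) assoc²

  -- Both sides reverse the order of the three factors.
  σ-reverse₃ : σ ∘ (σ {A} {B} ⊗₁ id {X}) ≈ α⇒ ∘ σ ∘ (id ⊗₁ σ) ∘ α⇒
  σ-reverse₃ = begin
    σ ∘ (σ ⊗₁ id)
      ≈⟨ hexagon₂ ⟩∘⟨refl ⟩
    (α⇒ ∘ (σ ⊗₁ id) ∘ α⇐ ∘ (id ⊗₁ σ) ∘ α⇒) ∘ (σ ⊗₁ id)
      ≈⟨ assoc⁴ ⟩
    α⇒ ∘ (σ ⊗₁ id) ∘ α⇐ ∘ (id ⊗₁ σ) ∘ α⇒ ∘ (σ ⊗₁ id)
      ≈⟨ refl⟩∘⟨ refl⟩∘⟨ refl⟩∘⟨ hexagon ⟨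
    α⇒ ∘ (σ ⊗₁ id) ∘ α⇐ ∘ α⇒ ∘ σ ∘ α⇒
      ≈⟨ refl⟩∘⟨ refl⟩∘⟨ cancelˡ α-isoˡ ⟩
    α⇒ ∘ (σ ⊗₁ id) ∘ σ ∘ α⇒
      ≈⟨ refl⟩∘⟨ extendʳ σ-natural ⟨
    α⇒ ∘ σ ∘ (id ⊗₁ σ) ∘ α⇒
      ∎

  -- IsAssociative μ is IsInvariant μ μ, and IsAssocBracketedMagma μ π is
  -- IsInvariant μ μ × IsInvariant μ π, definitionally.
  IsInvariant : ∀ {A} → (A ⊗₀ A) ⇒ A → (A ⊗₀ A) ⇒ Z → Set e
  IsInvariant μ β = β ∘ (μ ⊗₁ id) ≈ β ∘ (id ⊗₁ μ) ∘ α⇒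

  IsInvariant-resp-≈ : {μ : (A ⊗₀ A) ⇒ A} {β β′ : (A ⊗₀ A) ⇒ Z} →
                       β ≈ β′ → IsInvariant μ β → IsInvariant μ β′
  IsInvariant-resp-≈ β≈β′ inv =
    ≈.trans (≈.sym β≈β′ ⟩∘⟨refl) (≈.trans inv (β≈β′ ⟩∘⟨refl))

  IsInvariant-op : {μ : (A ⊗₀ A) ⇒ A} {β : (A ⊗₀ A) ⇒ Z} →
                   IsInvariant μ β → IsInvariant (μ ∘ σ) (β ∘ σ)
  IsInvariant-op {μ = μ} {β = β} inv = begin
    (β ∘ σ) ∘ ((μ ∘ σ) ⊗₁ id)                  ≈⟨ refl⟩∘⟨ ⊗id-homomorphism ⟩
    (β ∘ σ) ∘ (μ ⊗₁ id) ∘ (σ ⊗₁ id)            ≈⟨ assoc ⟩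
    β ∘ σ ∘ (μ ⊗₁ id) ∘ (σ ⊗₁ id)              ≈⟨ refl⟩∘⟨ extendʳ σ-natural ⟩
    β ∘ (id ⊗₁ μ) ∘ σ ∘ (σ ⊗₁ id)              ≈⟨ refl⟩∘⟨ refl⟩∘⟨ σ-reverse₃ ⟩
    β ∘ (id ⊗₁ μ) ∘ α⇒ ∘ σ ∘ (id ⊗₁ σ) ∘ α⇒    ≈⟨ assoc² ⟨
    (β ∘ (id ⊗₁ μ) ∘ α⇒) ∘ σ ∘ (id ⊗₁ σ) ∘ α⇒  ≈⟨ inv ⟩∘⟨refl ⟨
    (β ∘ (μ ⊗₁ id)) ∘ σ ∘ (id ⊗₁ σ) ∘ α⇒       ≈⟨ assoc ⟩
    β ∘ (μ ⊗₁ id) ∘ σ ∘ (id ⊗₁ σ) ∘ α⇒         ≈⟨ refl⟩∘⟨ extendʳ σ-natural ⟨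
    β ∘ σ ∘ (id ⊗₁ μ) ∘ (id ⊗₁ σ) ∘ α⇒         ≈⟨ sym-assoc ⟩
    (β ∘ σ) ∘ (id ⊗₁ μ) ∘ (id ⊗₁ σ) ∘ α⇒       ≈⟨ refl⟩∘⟨ sym-assoc ⟩
    (β ∘ σ) ∘ ((id ⊗₁ μ) ∘ (id ⊗₁ σ)) ∘ α⇒     ≈⟨ refl⟩∘⟨ id⊗-homomorphism ⟩∘⟨refl ⟨
    (β ∘ σ) ∘ (id ⊗₁ (μ ∘ σ)) ∘ α⇒             ∎

  IsBijection-∘ʳ : {φ : (X ⇒ Y) → (Z ⇒ W)} {ψ : (X ⇒ Y) → (A ⇒ W)} {k : A ⇒ Z} →
                   IsIso k → (∀ f → ψ f ≈ φ f ∘ k) → IsBijection φ → IsBijection ψ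
  IsBijection-∘ʳ {φ = φ} {ψ} {k} (k⁻¹ , k⁻¹k , kk⁻¹) ψ≈φ∘k (injective , surjective) =
    injective′ , surjective′
    where
    injective′ : ∀ f g → ψ f ≈ ψ g → f ≈ g
    injective′ f g p = injective f g
      (split-epi-cancelʳ kk⁻¹ (≈.trans (≈.sym (ψ≈φ∘k f)) (≈.trans p (ψ≈φ∘k g))))
    surjective′ : ∀ h → Σ _ λ f → ψ f ≈ h
    surjective′ h = let (f , φf≈h∘k⁻¹) = surjective (h ∘ k⁻¹) in
      f , ≈.trans (ψ≈φ∘k f) (≈.trans (φf≈h∘k⁻¹ ⟩∘⟨refl) (cancelʳ k⁻¹k))

  IsBijection-∘ˡ : {φ : (X ⇒ Y) → (Z ⇒ W)} {ψ : (X ⇒ A) → (Z ⇒ W)} {k : A ⇒ Y} →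
                   (∀ {f g} → f ≈ g → φ f ≈ φ g) →
                   IsIso k → (∀ f → ψ f ≈ φ (k ∘ f)) → IsBijection φ → IsBijection ψ
  IsBijection-∘ˡ {φ = φ} {ψ} {k} φ-resp-≈ (k⁻¹ , k⁻¹k , kk⁻¹) ψ≈φ∘k (injective , surjective) =
    injective′ , surjective′
    where
    injective′ : ∀ f g → ψ f ≈ ψ g → f ≈ g
    injective′ f g p = split-mono-cancelˡ k⁻¹k
      (injective _ _ (≈.trans (≈.sym (ψ≈φ∘k f)) (≈.trans p (ψ≈φ∘k g))))
    surjective′ : ∀ h → Σ _ λ f → ψ f ≈ h
    surjective′ h = let (f , φf≈h) = surjective h in
      k⁻¹ ∘ f , ≈.trans (ψ≈φ∘k _) (≈.trans (φ-resp-≈ (cancelˡ kk⁻¹)) φf≈h)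

  module DualPairing {ε : (A ⊗₀ B) ⇒ 𝟘} (ε-dual : IsDualPairing ε) where
    injectiveʳ : (f g : X ⇒ B) → ε ∘ (id ⊗₁ f) ≈ ε ∘ (id ⊗₁ g) → f ≈ g
    injectiveʳ {X} = proj₁ (proj₁ ε-dual X)

    surjectiveʳ : (h : (A ⊗₀ X) ⇒ 𝟘) → Σ (X ⇒ B) λ f → ε ∘ (id ⊗₁ f) ≈ h
    surjectiveʳ {X} = proj₂ (proj₁ ε-dual X)

  open DualPairing

  dual-pairing-∘σ : {ε : (A ⊗₀ B) ⇒ 𝟘} → IsDualPairing ε → IsDualPairing (ε ∘ σ)
  dual-pairing-∘σ (ε-dualʳ , ε-dualˡ) =
    (λ X → IsBijection-∘ʳ σ-iso (λ _ → ∘σ-swap) (ε-dualˡ X)) ,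
    (λ X → IsBijection-∘ʳ σ-iso (λ _ → ∘σ-swap) (ε-dualʳ X))

  dual-pairing-∘id⊗iso : {ε : (A ⊗₀ B) ⇒ 𝟘} {l : Y ⇒ B} →
                         IsDualPairing ε → IsIso l → IsDualPairing (ε ∘ (id ⊗₁ l))
  dual-pairing-∘id⊗iso (ε-dualʳ , ε-dualˡ) l-iso =
    (λ X → IsBijection-∘ˡ (λ p → refl⟩∘⟨ ⊗-resp-≈ ≈.refl p) l-iso (λ _ → pull-id⊗)
                          (ε-dualʳ X)) ,
    (λ X → IsBijection-∘ʳ (id⊗-iso l-iso) (λ _ → pull-⊗-interchange) (ε-dualˡ X))
    where
    pull-⊗-interchange : (h ∘ (id ⊗₁ f)) ∘ (g ⊗₁ id) ≈ (h ∘ (g ⊗₁ id)) ∘ (id ⊗₁ f)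
    pull-⊗-interchange =
      ≈.trans assoc (≈.trans (refl⟩∘⟨ ≈.sym ⊗-interchange) sym-assoc)

  dual-pairing-comparison-iso : {π : (A ⊗₀ Y) ⇒ 𝟘} {ε : (A ⊗₀ B) ⇒ 𝟘} {l : Y ⇒ B} →
                                IsDualPairing π → IsDualPairing ε →
                                ε ∘ (id ⊗₁ l) ≈ π → IsIso l
  dual-pairing-comparison-iso {π = π} {ε} {l} π-dual ε-dual εl≈π
    with surjectiveʳ π-dual ε
  ... | m , πm≈ε = m , injectiveʳ π-dual _ _ ml-pairing , injectiveʳ ε-dual _ _ lm-pairing
    where
    intro-id⊗id : ∀ {P} {β : (A ⊗₀ P) ⇒ 𝟘} → β ≈ β ∘ (id ⊗₁ id)
    intro-id⊗id = ≈.sym (≈.trans (refl⟩∘⟨ ⊗-identity) identityʳ)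
    ml-pairing : π ∘ (id ⊗₁ (m ∘ l)) ≈ π ∘ (id ⊗₁ id)
    ml-pairing = begin
      π ∘ (id ⊗₁ (m ∘ l))         ≈⟨ pull-id⊗ ⟨
      (π ∘ (id ⊗₁ m)) ∘ (id ⊗₁ l) ≈⟨ πm≈ε ⟩∘⟨refl ⟩
      ε ∘ (id ⊗₁ l)               ≈⟨ εl≈π ⟩
      π                           ≈⟨ intro-id⊗id ⟩
      π ∘ (id ⊗₁ id)              ∎
    lm-pairing : ε ∘ (id ⊗₁ (l ∘ m)) ≈ ε ∘ (id ⊗₁ id)
    lm-pairing = begin
      ε ∘ (id ⊗₁ (l ∘ m))         ≈⟨ pull-id⊗ ⟨
      (ε ∘ (id ⊗₁ l)) ∘ (id ⊗₁ m) ≈⟨ εl≈π ⟩∘⟨refl ⟩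
      π ∘ (id ⊗₁ m)               ≈⟨ πm≈ε ⟩
      ε                           ≈⟨ intro-id⊗id ⟩
      ε ∘ (id ⊗₁ id)              ∎

  left-action-exists : {ε : (A ⊗₀ B) ⇒ 𝟘} {μ : (A ⊗₀ A) ⇒ A} →
                       IsDualPairing ε → Σ ((A ⊗₀ B) ⇒ B) (IsLeftAction ε μ)
  left-action-exists {ε = ε} {μ} ε-dual = surjectiveʳ ε-dual (ε ∘ (μ ⊗₁ id) ∘ α⇐)

  right-action-exists : {ε : (A ⊗₀ B) ⇒ 𝟘} {μ : (A ⊗₀ A) ⇒ A} →
                        IsDualPairing ε → Σ ((B ⊗₀ A) ⇒ B) (IsRightAction ε μ)
  right-action-exists {ε = ε} {μ} ε-dual =
    let (▷ , ε▷≈) = surjectiveʳ ε-dual ((ε ∘ (μ ⊗₁ id) ∘ α⇐ ∘ σ) ∘ α⇐) in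
    ▷ , ≈.trans sym-assoc (≈.sym (switch-∘ʳ α-isoˡ (≈.sym ε▷≈)))

  left-action-pairing : {ε : (A ⊗₀ B) ⇒ 𝟘} {μ : (A ⊗₀ A) ⇒ A} {◁ : (A ⊗₀ B) ⇒ B}
                        {f : X ⇒ B} → IsLeftAction ε μ ◁ →
                        ε ∘ (id ⊗₁ (◁ ∘ (id ⊗₁ f))) ≈ (ε ∘ (id ⊗₁ f)) ∘ (μ ⊗₁ id) ∘ α⇐
  left-action-pairing {ε = ε} {μ} {◁} {f} ◁-action = begin
    ε ∘ (id ⊗₁ (◁ ∘ (id ⊗₁ f)))              ≈⟨ pull-id⊗ ⟨
    (ε ∘ (id ⊗₁ ◁)) ∘ (id ⊗₁ (id ⊗₁ f))      ≈⟨ ◁-action ⟩∘⟨refl ⟩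
    (ε ∘ (μ ⊗₁ id) ∘ α⇐) ∘ (id ⊗₁ (id ⊗₁ f)) ≈⟨ assoc² ⟩
    ε ∘ (μ ⊗₁ id) ∘ α⇐ ∘ (id ⊗₁ (id ⊗₁ f))   ≈⟨ refl⟩∘⟨ ⊗id∘α⇐-commute ⟩
    ε ∘ (id ⊗₁ f) ∘ (μ ⊗₁ id) ∘ α⇐           ≈⟨ sym-assoc ⟩
    (ε ∘ (id ⊗₁ f)) ∘ (μ ⊗₁ id) ∘ α⇐         ∎

  right-action-pairing : {ε : (A ⊗₀ B) ⇒ 𝟘} {μ : (A ⊗₀ A) ⇒ A} {▷ : (B ⊗₀ A) ⇒ B}
                         {f : X ⇒ B} → IsRightAction ε μ ▷ →
                         ε ∘ (id ⊗₁ (▷ ∘ (f ⊗₁ id)))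
                           ≈ (ε ∘ (id ⊗₁ f)) ∘ (μ ⊗₁ id) ∘ α⇐ ∘ σ ∘ α⇐
  right-action-pairing {ε = ε} {μ} {▷} {f} ▷-action = begin
    ε ∘ (id ⊗₁ (▷ ∘ (f ⊗₁ id)))
      ≈⟨ pull-id⊗ ⟨
    (ε ∘ (id ⊗₁ ▷)) ∘ (id ⊗₁ (f ⊗₁ id))
      ≈⟨ ε▷ ⟩∘⟨refl ⟩
    (ε ∘ (μ ⊗₁ id) ∘ α⇐ ∘ σ ∘ α⇐) ∘ (id ⊗₁ (f ⊗₁ id))
      ≈⟨ assoc⁴ ⟩
    ε ∘ (μ ⊗₁ id) ∘ α⇐ ∘ σ ∘ α⇐ ∘ (id ⊗₁ (f ⊗₁ id))
      ≈⟨ refl⟩∘⟨ refl⟩∘⟨ refl⟩∘⟨ refl⟩∘⟨ α⇐-natural ⟩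
    ε ∘ (μ ⊗₁ id) ∘ α⇐ ∘ σ ∘ ((id ⊗₁ f) ⊗₁ id) ∘ α⇐
      ≈⟨ refl⟩∘⟨ refl⟩∘⟨ refl⟩∘⟨ extendʳ σ-natural ⟩
    ε ∘ (μ ⊗₁ id) ∘ α⇐ ∘ (id ⊗₁ (id ⊗₁ f)) ∘ σ ∘ α⇐
      ≈⟨ refl⟩∘⟨ extend₃ʳ ⊗id∘α⇐-commute ⟩
    ε ∘ (id ⊗₁ f) ∘ (μ ⊗₁ id) ∘ α⇐ ∘ σ ∘ α⇐
      ≈⟨ sym-assoc ⟩
    (ε ∘ (id ⊗₁ f)) ∘ (μ ⊗₁ id) ∘ α⇐ ∘ σ ∘ α⇐
      ∎
    where
    ε▷ : ε ∘ (id ⊗₁ ▷) ≈ ε ∘ (μ ⊗₁ id) ∘ α⇐ ∘ σ ∘ α⇐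
    ε▷ = ≈.trans (switch-∘ʳ α-isoʳ (≈.trans assoc ▷-action)) assoc³

  module Compatibility {ε : (A ⊗₀ B) ⇒ 𝟘} {μ : (A ⊗₀ A) ⇒ A} {l r : A ⇒ B}
      (r-twist : ε ∘ (id ⊗₁ r) ≈ ε ∘ (id ⊗₁ l) ∘ σ)
      {◁ : (A ⊗₀ B) ⇒ B} {▷ : (B ⊗₀ A) ⇒ B}
      (◁-action : IsLeftAction ε μ ◁) (▷-action : IsRightAction ε μ ▷) where

    πˡ : (A ⊗₀ A) ⇒ 𝟘
    πˡ = ε ∘ (id ⊗₁ l)

    rotate : (A ⊗₀ (A ⊗₀ A)) ⇒ ((A ⊗₀ A) ⊗₀ A)
    rotate = α⇐ ∘ σ ∘ α⇐

    rotate-split-epi : rotate ∘ α⇒ ∘ σ ∘ α⇒ ≈ id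
    rotate-split-epi = begin
      (α⇐ ∘ σ ∘ α⇐) ∘ α⇒ ∘ σ ∘ α⇒ ≈⟨ assoc² ⟩
      α⇐ ∘ σ ∘ α⇐ ∘ α⇒ ∘ σ ∘ α⇒   ≈⟨ refl⟩∘⟨ refl⟩∘⟨ cancelˡ α-isoˡ ⟩
      α⇐ ∘ σ ∘ σ ∘ α⇒            ≈⟨ refl⟩∘⟨ cancelˡ σ-involutive ⟩
      α⇐ ∘ α⇒                   ≈⟨ α-isoˡ ⟩
      id                        ∎

    left-side : ε ∘ (id ⊗₁ (◁ ∘ (id ⊗₁ r))) ≈ (πˡ ∘ (id ⊗₁ μ) ∘ α⇒) ∘ rotate
    left-side = begin
      ε ∘ (id ⊗₁ (◁ ∘ (id ⊗₁ r)))          ≈⟨ left-action-pairing ◁-action ⟩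
      (ε ∘ (id ⊗₁ r)) ∘ (μ ⊗₁ id) ∘ α⇐     ≈⟨ ≈.trans r-twist sym-assoc ⟩∘⟨refl ⟩
      (πˡ ∘ σ) ∘ (μ ⊗₁ id) ∘ α⇐            ≈⟨ assoc ⟩
      πˡ ∘ σ ∘ (μ ⊗₁ id) ∘ α⇐              ≈⟨ refl⟩∘⟨ extendʳ σ-natural ⟩
      πˡ ∘ (id ⊗₁ μ) ∘ σ ∘ α⇐              ≈⟨ refl⟩∘⟨ refl⟩∘⟨ cancelˡ α-isoʳ ⟨
      πˡ ∘ (id ⊗₁ μ) ∘ α⇒ ∘ α⇐ ∘ σ ∘ α⇐    ≈⟨ assoc² ⟨
      (πˡ ∘ (id ⊗₁ μ) ∘ α⇒) ∘ rotate       ∎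

    right-side : ε ∘ (id ⊗₁ (▷ ∘ (l ⊗₁ id))) ≈ (πˡ ∘ (μ ⊗₁ id)) ∘ rotate
    right-side = ≈.trans (right-action-pairing ▷-action) sym-assoc

    compatible⇒invariant : ◁ ∘ (id ⊗₁ r) ≈ ▷ ∘ (l ⊗₁ id) → IsInvariant μ πˡ
    compatible⇒invariant compatible = split-epi-cancelʳ rotate-split-epi (begin
      (πˡ ∘ (μ ⊗₁ id)) ∘ rotate        ≈⟨ right-side ⟨
      ε ∘ (id ⊗₁ (▷ ∘ (l ⊗₁ id)))      ≈⟨ refl⟩∘⟨ ⊗-resp-≈ ≈.refl compatible ⟨
      ε ∘ (id ⊗₁ (◁ ∘ (id ⊗₁ r)))      ≈⟨ left-side ⟩
      (πˡ ∘ (id ⊗₁ μ) ∘ α⇒) ∘ rotate   ∎)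

    invariant⇒compatible : IsDualPairing ε → IsInvariant μ πˡ →
                           ◁ ∘ (id ⊗₁ r) ≈ ▷ ∘ (l ⊗₁ id)
    invariant⇒compatible ε-dual invariant = injectiveʳ ε-dual _ _ (begin
      ε ∘ (id ⊗₁ (◁ ∘ (id ⊗₁ r)))      ≈⟨ left-side ⟩
      (πˡ ∘ (id ⊗₁ μ) ∘ α⇒) ∘ rotate   ≈⟨ invariant ⟩∘⟨refl ⟨
      (πˡ ∘ (μ ⊗₁ id)) ∘ rotate        ≈⟨ right-side ⟨
      ε ∘ (id ⊗₁ (▷ ∘ (l ⊗₁ id)))      ∎)

  open Compatibility using (compatible⇒invariant; invariant⇒compatible)

  frobenius⇒bracketed-magma :
    {ε : (A ⊗₀ B) ⇒ 𝟘} {μ : (A ⊗₀ A) ⇒ A} {l r : A ⇒ B} → IsFrobenius ε μ l r →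
    IsAssocBracketedMagma μ (ε ∘ (id ⊗₁ l)) × IsCoAssociative μ (ε ∘ (id ⊗₁ r))
    × IsDualPairing (ε ∘ (id ⊗₁ l)) × IsDualPairing (ε ∘ (id ⊗₁ r))
  frobenius⇒bracketed-magma {ε = ε} {μ} {l}
    (ε-dual , μ-assoc , l-iso , r-iso , r-twist , compatible) =
    (μ-assoc , πˡ-invariant) ,
    (IsInvariant-op μ-assoc ,
     IsInvariant-resp-≈ (≈.trans assoc (≈.sym r-twist)) (IsInvariant-op πˡ-invariant)) ,
    dual-pairing-∘id⊗iso ε-dual l-iso , dual-pairing-∘id⊗iso ε-dual r-iso
    where
    πˡ-invariant : IsInvariant μ (ε ∘ (id ⊗₁ l))
    πˡ-invariant =
      let (◁ , ◁-action) = left-action-exists ε-dual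
          (▷ , ▷-action) = right-action-exists ε-dual
      in compatible⇒invariant r-twist ◁-action ▷-action (compatible ◁ ▷ ◁-action ▷-action)

  bracketed-magma⇒frobenius :
    {μ : (A ⊗₀ A) ⇒ A} {π : (A ⊗₀ A) ⇒ 𝟘} {ε : (A ⊗₀ B) ⇒ 𝟘} {l r : A ⇒ B} →
    IsAssocBracketedMagma μ π → IsDualPairing π → IsDualPairing ε →
    ε ∘ (id ⊗₁ l) ≈ π → ε ∘ (id ⊗₁ r) ≈ ε ∘ (id ⊗₁ l) ∘ σ →
    IsFrobenius ε μ l r
  bracketed-magma⇒frobenius (μ-assoc , π-invariant) π-dual ε-dual εl≈π r-twist =
    ε-dual , μ-assoc ,
    dual-pairing-comparison-iso π-dual ε-dual εl≈π ,
    dual-pairing-comparison-iso (dual-pairing-∘σ π-dual) ε-dual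
      (≈.trans r-twist (≈.trans sym-assoc (εl≈π ⟩∘⟨refl))) ,
    r-twist ,
    λ _ _ ◁-action ▷-action → invariant⇒compatible r-twist ◁-action ▷-action ε-dual
      (IsInvariant-resp-≈ (≈.sym εl≈π) π-invariant)

mainTheorem17 : ∀ {o ℓ e} (C : SymMonCat o ℓ e) (𝟘 : SymMonCat.Obj C) →
    let open SymMonCat C
        open Notions C 𝟘
    in (∀ {A B} (ε : (A ⊗₀ B) ⇒ 𝟘) (μ : (A ⊗₀ A) ⇒ A) (l r : A ⇒ B) →
          IsFrobenius ε μ l r →
          IsAssocBracketedMagma μ (ε ∘ (id ⊗₁ l))
          × IsCoAssociative μ (ε ∘ (id ⊗₁ r))
          × IsDualPairing (ε ∘ (id ⊗₁ l))
          × IsDualPairing (ε ∘ (id ⊗₁ r)))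
       × (∀ {A B} (μ : (A ⊗₀ A) ⇒ A) (π : (A ⊗₀ A) ⇒ 𝟘) (ε : (A ⊗₀ B) ⇒ 𝟘)
            (l r : A ⇒ B) →
          IsAssocBracketedMagma μ π → IsDualPairing π → IsDualPairing ε →
          ε ∘ (id ⊗₁ l) ≈ π → ε ∘ (id ⊗₁ r) ≈ ε ∘ (id ⊗₁ l) ∘ σ →
          IsFrobenius ε μ l r)
mainTheorem17 C 𝟘 =
  (λ _ _ _ _ → frobenius⇒bracketed-magma) , (λ _ _ _ _ _ → bracketed-magma⇒frobenius)
  where open FrobeniusStructures C 𝟘
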